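{- For any DATALOG$^r$ formula $(\Pi,P)\bar t$ the following are equivalent: (i) $(\Pi,P)\bar t$ is equivalent (on all finite structures) to a first-order formula; (ii) $(\Pi,P)\bar t$ is equivalent (on all finite structures) to a bounded DATALOG$^r$ formula.
   Context: All structures are finite. A DATALOG program $\Pi$ over a vocabulary $\tau$ is a finite set of rules $\beta\leftarrow\alpha_1,\dots,\alpha_l$ ($l\ge0$), where each $\alpha_i$ is an atomic formula, a negated atomic formula, or a zero-ary relation symbol, and the head $\beta$ is an atomic formula $R\bar x$ or a zero-ary relation symbol. Relation symbols occurring in some head are intentional; all other symbols (including constants) are extensional, forming $(\tau,\Pi)_{ext}$; intentional symbols occur only positively in the rules. A DATALOG$^r$ program additionally allows in rule bodies formulas $\forall\bar yR\bar y\bar z$ with $R$ intentional. Semantics: for a finite $(\tau,\Pi)_{ext}$-structure $\mathcal A$, intentional relations start as $R_{(0)}=\emptyset$ (zero-ary: FALSE), and $R_{(i+1)}$ is the set of tuples $\bar a$ such that for some rule with head $R\bar x$ and some assignment mapping $\bar x$ to $\bar a$, all body formulas hold in $\mathcal A$ expanded by the stage-$i$ relations; the stages increase to a fixed point $R_{(\infty)}=\bigcup_nR_{(n)}$. A DATALOG$^r$ formula $(\Pi,P)\bar t$ ($P$ an $r$-ary intentional symbol, $\bar t$ new variables) holds of $\bar a$ in $\mathcal A$ iff $\bar a\in P_{(\infty)}$. It is bounded if there is a fixed $k\ge0$ such that $P_{(k)}=P_{(\infty)}$ on all finite structures. -}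

module Defs where

open import Data.Nat using (ℕ; zero; suc; _+_)
open import Data.Fin using (Fin)
open import Data.Bool using (Bool; T)
open import Data.Vec using (Vec; map; _++_; lookup)
open import Data.List using (List)
open import Data.List.Relation.Unary.All using (All)
open import Data.List.Relation.Unary.Any using (Any)
open import Data.Product using (Σ; ∃; _×_)
open import Data.Sum using (_⊎_)
open import Data.Empty using (⊥)
open import Relation.Nullary using (¬_)
open import Relation.Binary.PropositionalEquality using (_≡_; subst; sym)

record Vocab : Set where
  field
    nRel   : ℕ
    arity  : Fin nRel → ℕ
    nConst : ℕ
open Vocab public

-- Finite structures: universe {0,…,size} (nonempty, finite); relations
-- are (decidable) subsets of tuples; constants are elements.  Every
-- finite structure is isomorphic to one of this form.

record Structure (σ : Vocab) : Set where
  field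
    size  : ℕ
    rel   : (R : Fin (nRel σ)) → Vec (Fin (suc size)) (arity σ R) → Bool
    const : Fin (nConst σ) → Fin (suc size)
open Structure public

Carrier : {σ : Vocab} → Structure σ → Set
Carrier A = Fin (suc (size A))

data Term (σ : Vocab) (m : ℕ) : Set where
  var : Fin m → Term σ m
  con : Fin (nConst σ) → Term σ m

⟦_⟧t : {σ : Vocab} {m : ℕ} → Term σ m → (A : Structure σ) → (Fin m → Carrier A) → Carrier A
⟦ var x ⟧t A s = s x
⟦ con c ⟧t A s = const A c

data Formula (σ : Vocab) : ℕ → Set where
  atom : ∀ {n} (R : Fin (nRel σ)) → Vec (Term σ n) (arity σ R) → Formula σ n
  eq   : ∀ {n} → Term σ n → Term σ n → Formula σ n
  neg  : ∀ {n} → Formula σ n → Formula σ n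
  and  : ∀ {n} → Formula σ n → Formula σ n → Formula σ n
  or   : ∀ {n} → Formula σ n → Formula σ n → Formula σ n
  ex   : ∀ {n} → Formula σ (suc n) → Formula σ n
  forall' : ∀ {n} → Formula σ (suc n) → Formula σ n

extend : {C : Set} {n : ℕ} → C → (Fin n → C) → Fin (suc n) → C
extend c s Fin.zero    = c
extend c s (Fin.suc i) = s i

Sat : {σ : Vocab} {n : ℕ} (A : Structure σ) → (Fin n → Carrier A) → Formula σ n → Set
Sat A s (atom R ts) = T (rel A R (map (λ t → ⟦ t ⟧t A s) ts))
Sat A s (eq t u)   = ⟦ t ⟧t A s ≡ ⟦ u ⟧t A s
Sat A s (neg φ)    = ¬ Sat A s φ
Sat A s (and φ ψ)  = Sat A s φ × Sat A s ψ
Sat A s (or φ ψ)   = Sat A s φ ⊎ Sat A s ψ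
Sat A s (ex φ)     = Σ (Carrier A) λ a → Sat A (extend a s) φ
Sat A s (forall' φ)    = (a : Carrier A) → Sat A (extend a s) φ

-- DATALOG^r programs.  The extensional vocabulary (τ,Π)_ext is σ; the
-- intentional symbols are Fin nI with arities ia (arity 0 = zero-ary).

data Literal (σ : Vocab) {nI : ℕ} (ia : Fin nI → ℕ) (m : ℕ) : Set where
  ext+ : (R : Fin (nRel σ)) → Vec (Term σ m) (arity σ R) → Literal σ ia m
  ext- : (R : Fin (nRel σ)) → Vec (Term σ m) (arity σ R) → Literal σ ia m
  eq+  : Term σ m → Term σ m → Literal σ ia m
  eq-  : Term σ m → Term σ m → Literal σ ia m
  int+ : (R : Fin nI) → Vec (Term σ m) (ia R) → Literal σ ia m
  -- ∀ y₁…yⱼ R y₁…yⱼ z₁…zₖ with R intentional of arity j + k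
  int∀ : (R : Fin nI) (j k : ℕ) → j + k ≡ ia R → Vec (Fin m) k → Literal σ ia m

record Rule (σ : Vocab) {nI : ℕ} (ia : Fin nI → ℕ) : Set where
  field
    nVar     : ℕ
    head     : Fin nI
    headArgs : Vec (Fin nVar) (ia head)
    body     : List (Literal σ ia nVar)

record Program (σ : Vocab) : Set where
  field
    nInt   : ℕ
    iarity : Fin nInt → ℕ
    rules  : List (Rule σ iarity)
open Program public

Interp : {σ : Vocab} (Π : Program σ) (A : Structure σ) → Set₁
Interp Π A = (R : Fin (nInt Π)) → Vec (Carrier A) (iarity Π R) → Set

HoldsLit : {σ : Vocab} (Π : Program σ) (A : Structure σ) → Interp Π A →
           {m : ℕ} → (Fin m → Carrier A) → Literal σ (iarity Π) m → Set
HoldsLit Π A I s (ext+ R ts) = T (rel A R (map (λ t → ⟦ t ⟧t A s) ts))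
HoldsLit Π A I s (ext- R ts) = ¬ T (rel A R (map (λ t → ⟦ t ⟧t A s) ts))
HoldsLit Π A I s (eq+ t u)   = ⟦ t ⟧t A s ≡ ⟦ u ⟧t A s
HoldsLit Π A I s (eq- t u)   = ¬ (⟦ t ⟧t A s ≡ ⟦ u ⟧t A s)
HoldsLit Π A I s (int+ R ts) = I R (map (λ t → ⟦ t ⟧t A s) ts)
HoldsLit Π A I s (int∀ R j k e zs) =
  (ys : Vec (Carrier A) j) → I R (subst (Vec (Carrier A)) e (ys ++ map s zs))

Fires : {σ : Vocab} (Π : Program σ) (A : Structure σ) → Interp Π A →
        Rule σ (iarity Π) → (R : Fin (nInt Π)) → Vec (Carrier A) (iarity Π R) → Set
Fires Π A I ρ R a =
  Σ (Rule.head ρ ≡ R) λ e →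
  Σ (Fin (Rule.nVar ρ) → Carrier A) λ s →
    (subst (λ Q → Vec (Carrier A) (iarity Π Q)) e (map s (Rule.headArgs ρ)) ≡ a)
    × All (HoldsLit Π A I s) (Rule.body ρ)

Stage : {σ : Vocab} (Π : Program σ) (A : Structure σ) → ℕ → Interp Π A
Stage Π A zero    R a = ⊥
Stage Π A (suc i) R a = Any (λ ρ → Fires Π A (Stage Π A i) ρ R a) (rules Π)

Stage∞ : {σ : Vocab} (Π : Program σ) (A : Structure σ) → Interp Π A
Stage∞ Π A R a = ∃ λ n → Stage Π A n R a

record DFormula (σ : Vocab) (r : ℕ) : Set where
  field
    prog  : Program σ
    P     : Fin (nInt prog)
    arP   : iarity prog P ≡ r
open DFormula public

_⇔'_ : Set → Set → Set
X ⇔' Y = (X → Y) × (Y → X)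

HoldsAt : {σ : Vocab} {r : ℕ} (D : DFormula σ r) (A : Structure σ) → ℕ → Vec (Carrier A) r → Set
HoldsAt D A n a = Stage (prog D) A n (P D) (subst (Vec (Carrier A)) (sym (arP D)) a)

HoldsD : {σ : Vocab} {r : ℕ} (D : DFormula σ r) (A : Structure σ) → Vec (Carrier A) r → Set
HoldsD D A a = Stage∞ (prog D) A (P D) (subst (Vec (Carrier A)) (sym (arP D)) a)

Bounded : {σ : Vocab} {r : ℕ} → DFormula σ r → Set
Bounded {σ} {r} D = Σ ℕ λ k → (A : Structure σ) (a : Vec (Carrier A) r) → HoldsAt D A k a ⇔' HoldsD D A a

EquivFO : {σ : Vocab} {r : ℕ} → DFormula σ r → Formula σ r → Set
EquivFO {σ} {r} D φ = (A : Structure σ) (a : Vec (Carrier A) r) → HoldsD D A a ⇔' Sat A (lookup a) φ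

EquivD : {σ : Vocab} {r : ℕ} → DFormula σ r → DFormula σ r → Set
EquivD {σ} {r} D D' = (A : Structure σ) (a : Vec (Carrier A) r) → HoldsD D A a ⇔' HoldsD D' A a

module Submission where

-- (ii) ⇒ (i): by induction on k, the k-th stage of any DATALOG^r program is first-order definable: R_(0)
-- is ⊥, a rule fires iff some assignment of its variables matches the head and satisfies the body, and a
-- body formula ∀ȳ R ȳ z̄ becomes a block of universal quantifiers. If P_(k) = P_(∞), the formula for
-- P_(k) therefore defines (Π,P).
--
-- (i) ⇒ (ii): bring φ into negation normal form and give every subformula its own intentional predicate,
-- defined by one rule per connective from the predicates of its immediate subformulas; negation is only
-- needed on extensional literals, and ∀ is expressed by the body formula ∀y R y z̄. Every rule is sound for the
-- intended meaning of the predicates, so all stages lie below it, and by induction a subformula with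
-- n nodes is derived by stage n. Hence P_(∞) = P_(nodes+1) defines φ.

open import Defs
open import Data.Bool using (T)
open import Data.Empty using (⊥-elim)
open import Data.Fin using (Fin; zero; suc; _↑ˡ_; _↑ʳ_; inject≤; inject₁)
import Data.Fin as Fin
open import Data.Fin.Properties using (any?; all?; ¬∀⟶∃¬; toℕ-injective; toℕ-inject≤; toℕ-inject₁)
open import Data.List using (List; []; _∷_; _++_)
open import Data.List.Membership.Propositional using (_∈_; lose)
open import Data.List.Membership.Propositional.Properties using (∈-++⁺ˡ; ∈-++⁺ʳ)
open import Data.List.Relation.Binary.Subset.Propositional using (_⊆_)
open import Data.List.Relation.Unary.All as All using (All; []; _∷_)
import Data.List.Relation.Unary.All.Properties as All
open import Data.List.Relation.Unary.Any using (Any; here; there)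
open import Data.Nat using (ℕ; zero; suc; _+_; _≤_; s≤s)
open import Data.Nat.Properties
  using (≤-refl; ≤-trans; +-monoʳ-≤; m≤n⇒m≤1+n; m≤m+n; m≤n+m; +-suc; n≤1+n; m+n≤o⇒m≤o; m+n≤o⇒n≤o)
open import Data.Product using (Σ; _×_; _,_; proj₁; proj₂)
open import Data.Sum using (_⊎_; inj₁; inj₂)
import Data.Sum
open import Data.Vec using (Vec; []; _∷_; map; lookup; tabulate; padRight)
  renaming (_++_ to _++ᵛ_)
open import Data.Vec.Functional using () renaming (_++_ to _++ᶠ_)
open import Data.Vec.Functional.Properties using (lookup-++ˡ; lookup-++ʳ)
open import Data.Vec.Properties
  using (lookup-map; ∷-injective; map-∘; map-cong; map-++; lookup∘tabulate; tabulate∘lookup; tabulate-∘; tabulate-cong)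
open import Function using (_∘_; id; case_of_)
open import Relation.Binary.PropositionalEquality
open import Relation.Nullary using (¬_; Dec; yes; no)
open import Relation.Nullary.Decidable using (decidable-stable; _×-dec_; _⊎-dec_; ¬?; T?)

⇔-sym : {X Y : Set} → X ⇔' Y → Y ⇔' X
⇔-sym (f , g) = g , f

⇔-trans : {X Y Z : Set} → X ⇔' Y → Y ⇔' Z → X ⇔' Z
⇔-trans (f , g) (f′ , g′) = f′ ∘ f , g ∘ g′

≡⇒⇔ : {X Y : Set} → X ≡ Y → X ⇔' Y
≡⇒⇔ refl = id , id

extendAll : {C : Set} {m : ℕ} (N : ℕ) → (Fin N → C) → (Fin m → C) → Fin (N + m) → C
extendAll zero    t s = s
extendAll (suc N) t s = extend (t zero) (extendAll N (t ∘ suc) s)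

extendAll-↑ˡ : {C : Set} {m : ℕ} (N : ℕ) (t : Fin N → C) (s : Fin m → C) (i : Fin N) →
               extendAll N t s (i ↑ˡ m) ≡ t i
extendAll-↑ˡ (suc N) t s zero    = refl
extendAll-↑ˡ (suc N) t s (suc i) = extendAll-↑ˡ N (t ∘ suc) s i

extendAll-↑ʳ : {C : Set} {m : ℕ} (N : ℕ) (t : Fin N → C) (s : Fin m → C) (j : Fin m) →
               extendAll N t s (N ↑ʳ j) ≡ s j
extendAll-↑ʳ zero    t s j = refl
extendAll-↑ʳ (suc N) t s j = extendAll-↑ʳ N (t ∘ suc) s j

module _ {σ : Vocab} where

  renameᵗ : {m m′ : ℕ} → (Fin m → Fin m′) → Term σ m → Term σ m′
  renameᵗ f (var x) = var (f x)
  renameᵗ f (con c) = con c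

  ⟦_⟧ts : {m k : ℕ} → Vec (Term σ m) k → (A : Structure σ) → (Fin m → Carrier A) → Vec (Carrier A) k
  ⟦ ts ⟧ts A s = map (λ t → ⟦ t ⟧t A s) ts

  module _ (A : Structure σ) where

    ⟦renameᵗ⟧ : {m m′ : ℕ} (f : Fin m → Fin m′) (s : Fin m′ → Carrier A) (t : Term σ m) →
                ⟦ renameᵗ f t ⟧t A s ≡ ⟦ t ⟧t A (s ∘ f)
    ⟦renameᵗ⟧ f s (var x) = refl
    ⟦renameᵗ⟧ f s (con c) = refl

    ⟦⟧t-cong : {m : ℕ} {s s′ : Fin m → Carrier A} → s ≗ s′ → (t : Term σ m) → ⟦ t ⟧t A s ≡ ⟦ t ⟧t A s′
    ⟦⟧t-cong s≗s′ (var x) = s≗s′ x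
    ⟦⟧t-cong s≗s′ (con c) = refl

    ⟦renameᵗ⟧ts : {m m′ k : ℕ} (f : Fin m → Fin m′) (s : Fin m′ → Carrier A) (ts : Vec (Term σ m) k) →
                  ⟦ map (renameᵗ f) ts ⟧ts A s ≡ ⟦ ts ⟧ts A (s ∘ f)
    ⟦renameᵗ⟧ts f s ts = trans (sym (map-∘ _ _ ts)) (map-cong (⟦renameᵗ⟧ f s) ts)

    ⟦⟧ts-cong : {m k : ℕ} {s s′ : Fin m → Carrier A} → s ≗ s′ → (ts : Vec (Term σ m) k) →
                ⟦ ts ⟧ts A s ≡ ⟦ ts ⟧ts A s′
    ⟦⟧ts-cong s≗s′ = map-cong (⟦⟧t-cong s≗s′)

    ⟦tabulate-var⟧ : {m k : ℕ} (f : Fin k → Fin m) (s : Fin m → Carrier A) →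
                     ⟦ tabulate (var ∘ f) ⟧ts A s ≡ tabulate (s ∘ f)
    ⟦tabulate-var⟧ f s = sym (tabulate-∘ _ (var ∘ f))

    extend-cong : {n : ℕ} (a : Carrier A) {s s′ : Fin n → Carrier A} → s ≗ s′ → extend a s ≗ extend a s′
    extend-cong a s≗s′ zero    = refl
    extend-cong a s≗s′ (suc i) = s≗s′ i

    Sat-cong : {n : ℕ} {s s′ : Fin n → Carrier A} → s ≗ s′ → (φ : Formula σ n) → Sat A s φ → Sat A s′ φ
    Sat-cong s≗s′ (atom R ts)  = subst (T ∘ rel A R) (⟦⟧ts-cong s≗s′ ts)
    Sat-cong s≗s′ (eq t u) t≡u = trans (sym (⟦⟧t-cong s≗s′ t)) (trans t≡u (⟦⟧t-cong s≗s′ u))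
    Sat-cong s≗s′ (neg φ) ¬φ   = ¬φ ∘ Sat-cong (sym ∘ s≗s′) φ
    Sat-cong s≗s′ (and φ ψ) (x , y) = Sat-cong s≗s′ φ x , Sat-cong s≗s′ ψ y
    Sat-cong s≗s′ (or φ ψ) (inj₁ x) = inj₁ (Sat-cong s≗s′ φ x)
    Sat-cong s≗s′ (or φ ψ) (inj₂ y) = inj₂ (Sat-cong s≗s′ ψ y)
    Sat-cong s≗s′ (ex φ) (a , x)    = a , Sat-cong (extend-cong a s≗s′) φ x
    Sat-cong s≗s′ (forall' φ) x a   = Sat-cong (extend-cong a s≗s′) φ (x a)

    Sat? : {n : ℕ} (s : Fin n → Carrier A) (φ : Formula σ n) → Dec (Sat A s φ)
    Sat? s (atom R ts)  = T? _
    Sat? s (eq t u)     = ⟦ t ⟧t A s Fin.≟ ⟦ u ⟧t A s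
    Sat? s (neg φ)      = ¬? (Sat? s φ)
    Sat? s (and φ ψ)    = Sat? s φ ×-dec Sat? s ψ
    Sat? s (or φ ψ)     = Sat? s φ ⊎-dec Sat? s ψ
    Sat? s (ex φ)       = any? λ a → Sat? (extend a s) φ
    Sat? s (forall' φ)  = all? λ a → Sat? (extend a s) φ

  ⊤F : {m : ℕ} → Formula σ m
  ⊤F = forall' (eq (var zero) (var zero))

  ⊥F : {m : ℕ} → Formula σ m
  ⊥F = neg ⊤F

  ¬Sat-⊥F : {m : ℕ} (A : Structure σ) (s : Fin m → Carrier A) → ¬ Sat A s ⊥F
  ¬Sat-⊥F A s ¬⊤ = ¬⊤ λ _ → refl

-- Stages lie below every model of a program

module _ {σ : Vocab} (Π : Program σ) (A : Structure σ) where

  _⊆ᴵ_ : Interp Π A → Interp Π A → Set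
  I ⊆ᴵ J = ∀ R a → I R a → J R a

  HoldsLit-mono : {I J : Interp Π A} → I ⊆ᴵ J → {m : ℕ} (s : Fin m → Carrier A) {l : Literal σ (iarity Π) m} →
                  HoldsLit Π A I s l → HoldsLit Π A J s l
  HoldsLit-mono I⊆J s {ext+ R ts}       x = x
  HoldsLit-mono I⊆J s {ext- R ts}       x = x
  HoldsLit-mono I⊆J s {eq+ t u}         x = x
  HoldsLit-mono I⊆J s {eq- t u}         x = x
  HoldsLit-mono I⊆J s {int+ R ts}       x = I⊆J R _ x
  HoldsLit-mono I⊆J s {int∀ R j k e zs} x = λ ys → I⊆J R _ (x ys)

  Respects : Interp Π A → Rule σ (iarity Π) → Set
  Respects I ρ = (s : Fin (Rule.nVar ρ) → Carrier A) → All (HoldsLit Π A I s) (Rule.body ρ) →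
                 I (Rule.head ρ) (map s (Rule.headArgs ρ))

  Stage⊆model : {I : Interp Π A} → All (Respects I) (rules Π) → ∀ m → Stage Π A m ⊆ᴵ I
  Stage⊆model {I} model (suc m) R a = All.lookupWith fired model
    where
      fired : ∀ {ρ} → Respects I ρ → Fires Π A (Stage Π A m) ρ R a → I R a
      fired respects (refl , s , refl , body) =
        respects s (All.map (λ {l} → HoldsLit-mono (Stage⊆model model m) s {l}) body)

  Stage-fire : {m : ℕ} {ρ : Rule σ (iarity Π)} → ρ ∈ rules Π → (s : Fin (Rule.nVar ρ) → Carrier A) →
               All (HoldsLit Π A (Stage Π A m) s) (Rule.body ρ) →
               Stage Π A (suc m) (Rule.head ρ) (map s (Rule.headArgs ρ))
  Stage-fire ρ∈Π s body = lose ρ∈Π (refl , s , refl , body)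

-- (ii) ⇒ (i): every stage is first-order

module _ {σ : Vocab} where

  ∃* : {m : ℕ} (N : ℕ) → Formula σ (N + m) → Formula σ m
  ∃* zero    φ = φ
  ∃* (suc N) φ = ∃* N (ex φ)

  ∀* : {m : ℕ} (N : ℕ) → Formula σ (N + m) → Formula σ m
  ∀* zero    φ = φ
  ∀* (suc N) φ = ∀* N (forall' φ)

  eqsF : {m k : ℕ} → Vec (Term σ m) k → Vec (Term σ m) k → Formula σ m
  eqsF []       []       = ⊤F
  eqsF (t ∷ ts) (u ∷ us) = and (eq t u) (eqsF ts us)

  module _ (A : Structure σ) where

    Sat-∃* : {m : ℕ} (N : ℕ) (s : Fin m → Carrier A) (φ : Formula σ (N + m)) →
             Sat A s (∃* N φ) ⇔' Σ (Fin N → Carrier A) λ t → Sat A (extendAll N t s) φ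
    Sat-∃* zero    s φ = (λ x → (λ ()) , x) , proj₂
    Sat-∃* (suc N) s φ =
      (λ x → let (t , a , y) = proj₁ (Sat-∃* N s (ex φ)) x in extend a t , y) ,
      (λ (t , y) → proj₂ (Sat-∃* N s (ex φ)) (t ∘ suc , t zero , y))

    Sat-∀* : {m : ℕ} (N : ℕ) (s : Fin m → Carrier A) (φ : Formula σ (N + m)) →
             Sat A s (∀* N φ) ⇔' ((t : Fin N → Carrier A) → Sat A (extendAll N t s) φ)
    Sat-∀* zero    s φ = (λ x t → x) , (λ x → x λ ())
    Sat-∀* (suc N) s φ =
      (λ x t → proj₁ (Sat-∀* N s (forall' φ)) x (t ∘ suc) (t zero)) ,
      (λ x → proj₂ (Sat-∀* N s (forall' φ)) λ t a → x (extend a t))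

    Sat-eqsF : {m k : ℕ} (s : Fin m → Carrier A) (ts us : Vec (Term σ m) k) →
               Sat A s (eqsF ts us) ⇔' (⟦ ts ⟧ts A s ≡ ⟦ us ⟧ts A s)
    Sat-eqsF s []       []       = (λ _ → refl) , (λ _ _ → refl)
    Sat-eqsF s (t ∷ ts) (u ∷ us) =
      (λ (t≡u , ts≡us) → cong₂ _∷_ t≡u (proj₁ (Sat-eqsF s ts us) ts≡us)) ,
      (λ eqs → let (t≡u , ts≡us) = ∷-injective eqs in t≡u , proj₂ (Sat-eqsF s ts us) ts≡us)

    ⟦lift⟧ts : {N m k : ℕ} (t : Fin N → Carrier A) (s : Fin m → Carrier A) (ts : Vec (Term σ N) k) →
               ⟦ map (renameᵗ (_↑ˡ m)) ts ⟧ts A (extendAll N t s) ≡ ⟦ ts ⟧ts A t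
    ⟦lift⟧ts {N} t s ts = trans (⟦renameᵗ⟧ts A _ _ ts) (⟦⟧ts-cong A (extendAll-↑ˡ N t s) ts)

    ⟦raise⟧ts : {N m k : ℕ} (t : Fin N → Carrier A) (s : Fin m → Carrier A) (ts : Vec (Term σ m) k) →
                ⟦ map (renameᵗ (N ↑ʳ_)) ts ⟧ts A (extendAll N t s) ≡ ⟦ ts ⟧ts A s
    ⟦raise⟧ts {N} t s ts = trans (⟦renameᵗ⟧ts A _ _ ts) (⟦⟧ts-cong A (extendAll-↑ʳ N t s) ts)

    ⟦subst⟧ts : {m k k′ : ℕ} (e : k ≡ k′) (s : Fin m → Carrier A) (ts : Vec (Term σ m) k) →
                ⟦ subst (Vec (Term σ m)) e ts ⟧ts A s ≡ subst (Vec (Carrier A)) e (⟦ ts ⟧ts A s)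
    ⟦subst⟧ts refl s ts = refl

module Unfold {σ : Vocab} (Π : Program σ) where

  Rl : Set
  Rl = Rule σ (iarity Π)

  Lit : ℕ → Set
  Lit = Literal σ (iarity Π)

  lift : {N m : ℕ} → Term σ N → Term σ (N + m)
  lift {m = m} = renameᵗ (_↑ˡ m)

  ∀-args : {N m : ℕ} (j k : ℕ) → Vec (Fin N) k → Vec (Term σ (j + (N + m))) (j + k)
  ∀-args {N} {m} j k zs = tabulate (var ∘ (_↑ˡ (N + m))) ++ᵛ map (renameᵗ (j ↑ʳ_) ∘ lift ∘ var) zs

  mutual
    stageF : {m : ℕ} → ℕ → (R : Fin (nInt Π)) → Vec (Term σ m) (iarity Π R) → Formula σ m
    stageF zero    R ts = ⊥F
    stageF (suc n) R ts = anyRuleF n (rules Π) R ts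

    anyRuleF : {m : ℕ} → ℕ → List Rl → (R : Fin (nInt Π)) → Vec (Term σ m) (iarity Π R) → Formula σ m
    anyRuleF n []       R ts = ⊥F
    anyRuleF n (ρ ∷ ρs) R ts = or (firesF n ρ R ts (Rule.head ρ Fin.≟ R)) (anyRuleF n ρs R ts)

    firesF : {m : ℕ} → ℕ → (ρ : Rl) → (R : Fin (nInt Π)) → Vec (Term σ m) (iarity Π R) →
             Dec (Rule.head ρ ≡ R) → Formula σ m
    firesF n ρ R ts (no _)    = ⊥F
    firesF n ρ R ts (yes refl) =
      ∃* (Rule.nVar ρ) (and (eqsF (map (lift ∘ var) (Rule.headArgs ρ)) (map (renameᵗ (Rule.nVar ρ ↑ʳ_)) ts))
                            (bodyF n (Rule.body ρ)))

    bodyF : {N m : ℕ} → ℕ → List (Lit N) → Formula σ (N + m)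
    bodyF n []       = ⊤F
    bodyF n (l ∷ ls) = and (literalF n l) (bodyF n ls)

    literalF : {N m : ℕ} → ℕ → Lit N → Formula σ (N + m)
    literalF n (ext+ R ts)       = atom R (map lift ts)
    literalF n (ext- R ts)       = neg (atom R (map lift ts))
    literalF n (eq+ t u)         = eq (lift t) (lift u)
    literalF n (eq- t u)         = neg (eq (lift t) (lift u))
    literalF n (int+ Q ts)       = stageF n Q (map lift ts)
    literalF {N} {m} n (int∀ Q j k e zs) =
      ∀* j (stageF n Q (subst (Vec (Term σ (j + (N + m)))) e (∀-args {N} {m} j k zs)))

  module _ (A : Structure σ) where

    private
      C = Carrier A

      ⟦lift⟧ : {N m : ℕ} (t : Fin N → C) (s : Fin m → C) (u : Term σ N) →
               ⟦ lift {m = m} u ⟧t A (extendAll N t s) ≡ ⟦ u ⟧t A t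
      ⟦lift⟧ {N} t s u = trans (⟦renameᵗ⟧ A _ _ u) (⟦⟧t-cong A (extendAll-↑ˡ N t s) u)

      ⟦∀-args⟧ : {N m : ℕ} (j k : ℕ) (f : Fin j → C) (t : Fin N → C) (s : Fin m → C) (zs : Vec (Fin N) k) →
                 ⟦ ∀-args {N} {m} j k zs ⟧ts A (extendAll j f (extendAll N t s)) ≡ tabulate f ++ᵛ map t zs
      ⟦∀-args⟧ {N} {m} j k f t s zs = begin
          ⟦ ∀-args j k zs ⟧ts A s′
        ≡⟨ map-++ _ (tabulate (var ∘ (_↑ˡ (N + m)))) (map (renameᵗ (j ↑ʳ_) ∘ lift ∘ var) zs) ⟩
          ⟦ tabulate (var ∘ (_↑ˡ (N + m))) ⟧ts A s′ ++ᵛ ⟦ map (renameᵗ (j ↑ʳ_) ∘ lift ∘ var) zs ⟧ts A s′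
        ≡⟨ cong₂ _++ᵛ_ (trans (⟦tabulate-var⟧ A _ s′) (tabulate-cong (extendAll-↑ˡ j f _)))
                        (trans (sym (map-∘ _ _ zs)) (map-cong ⟦zs⟧ zs)) ⟩
          tabulate f ++ᵛ map t zs
        ∎
        where
          open ≡-Reasoning
          s′ = extendAll j f (extendAll N t s)
          ⟦zs⟧ : (z : Fin N) → ⟦ renameᵗ (j ↑ʳ_) (lift (var z)) ⟧t A s′ ≡ t z
          ⟦zs⟧ z = trans (extendAll-↑ʳ j f _ (z ↑ˡ m)) (extendAll-↑ˡ N t s z)

    mutual
      Sat-stageF : (n : ℕ) {m : ℕ} (s : Fin m → C) (R : Fin (nInt Π)) (ts : Vec (Term σ m) (iarity Π R)) →
                   Sat A s (stageF n R ts) ⇔' Stage Π A n R (⟦ ts ⟧ts A s)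
      Sat-stageF zero    s R ts = (λ x → ⊥-elim (¬Sat-⊥F A s x)) , λ ()
      Sat-stageF (suc n) s R ts = Sat-anyRuleF n (rules Π) s R ts

      Sat-anyRuleF : (n : ℕ) (ρs : List Rl) {m : ℕ} (s : Fin m → C) (R : Fin (nInt Π))
                     (ts : Vec (Term σ m) (iarity Π R)) →
                     Sat A s (anyRuleF n ρs R ts) ⇔' Any (λ ρ → Fires Π A (Stage Π A n) ρ R (⟦ ts ⟧ts A s)) ρs
      Sat-anyRuleF n []       s R ts = (λ x → ⊥-elim (¬Sat-⊥F A s x)) , λ ()
      Sat-anyRuleF n (ρ ∷ ρs) s R ts =
        (λ { (inj₁ x) → here (proj₁ (Sat-firesF n ρ s R ts (Rule.head ρ Fin.≟ R)) x)
           ; (inj₂ y) → there (proj₁ (Sat-anyRuleF n ρs s R ts) y) }) ,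
        (λ { (here x)  → inj₁ (proj₂ (Sat-firesF n ρ s R ts (Rule.head ρ Fin.≟ R)) x)
           ; (there y) → inj₂ (proj₂ (Sat-anyRuleF n ρs s R ts) y) })

      Sat-firesF : (n : ℕ) (ρ : Rl) {m : ℕ} (s : Fin m → C) (R : Fin (nInt Π))
                   (ts : Vec (Term σ m) (iarity Π R)) (d : Dec (Rule.head ρ ≡ R)) →
                   Sat A s (firesF n ρ R ts d) ⇔' Fires Π A (Stage Π A n) ρ R (⟦ ts ⟧ts A s)
      Sat-firesF n ρ s R ts (no head≢R) = (λ x → ⊥-elim (¬Sat-⊥F A s x)) , ⊥-elim ∘ head≢R ∘ proj₁
      Sat-firesF n ρ {m} s R ts (yes refl) =
        (λ x → let (t , heads , body) = proj₁ (Sat-∃* A N s _) x in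
           refl , t , trans (sym (⟦head⟧ t)) (trans (proj₁ (Sat-eqsF A _ _ _) heads) (⟦raise⟧ts A t s ts)) ,
           proj₁ (Sat-bodyF n (Rule.body ρ) t s) body) ,
        (λ { (refl , t , heads , body) → proj₂ (Sat-∃* A N s _)
           (t , proj₂ (Sat-eqsF A _ _ _) (trans (⟦head⟧ t) (trans heads (sym (⟦raise⟧ts A t s ts)))) ,
            proj₂ (Sat-bodyF n (Rule.body ρ) t s) body) })
        where
          N = Rule.nVar ρ
          ⟦head⟧ : (t : Fin N → C) →
                   ⟦ map (lift {m = m} ∘ var) (Rule.headArgs ρ) ⟧ts A (extendAll N t s) ≡ map t (Rule.headArgs ρ)
          ⟦head⟧ t = trans (sym (map-∘ _ _ (Rule.headArgs ρ))) (map-cong (⟦lift⟧ t s ∘ var) _)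

      Sat-bodyF : (n : ℕ) {N m : ℕ} (ls : List (Lit N)) (t : Fin N → C) (s : Fin m → C) →
                  Sat A (extendAll N t s) (bodyF n ls) ⇔' All (HoldsLit Π A (Stage Π A n) t) ls
      Sat-bodyF n []       t s = (λ _ → []) , (λ _ _ → refl)
      Sat-bodyF n (l ∷ ls) t s =
        (λ (x , y) → proj₁ (Sat-literalF n l t s) x ∷ proj₁ (Sat-bodyF n ls t s) y) ,
        (λ { (x ∷ y) → proj₂ (Sat-literalF n l t s) x , proj₂ (Sat-bodyF n ls t s) y })

      Sat-literalF : (n : ℕ) {N m : ℕ} (l : Lit N) (t : Fin N → C) (s : Fin m → C) →
                     Sat A (extendAll N t s) (literalF n l) ⇔' HoldsLit Π A (Stage Π A n) t l
      Sat-literalF n (ext+ R ts) t s = ≡⇒⇔ (cong (T ∘ rel A R) (⟦lift⟧ts A t s ts))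
      Sat-literalF n (ext- R ts) t s = ≡⇒⇔ (cong (¬_ ∘ T ∘ rel A R) (⟦lift⟧ts A t s ts))
      Sat-literalF n (eq+ u w)   t s = ≡⇒⇔ (cong₂ _≡_ (⟦lift⟧ t s u) (⟦lift⟧ t s w))
      Sat-literalF n (eq- u w)   t s = ≡⇒⇔ (cong₂ (λ x y → ¬ x ≡ y) (⟦lift⟧ t s u) (⟦lift⟧ t s w))
      Sat-literalF n {N} (int+ Q ts) t s =
        ⇔-trans (Sat-stageF n _ Q (map lift ts)) (≡⇒⇔ (cong (Stage Π A n Q) (⟦lift⟧ts A t s ts)))
      Sat-literalF n {N} {m} (int∀ Q j k e zs) t s =
        (λ x ys → subst (Stage Π A n Q) (⟦args⟧ (lookup ys) ys (tabulate∘lookup ys))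
                    (proj₁ (Sat-stageF n _ Q args) (proj₁ (Sat-∀* A j _ _) x (lookup ys)))) ,
        (λ x → proj₂ (Sat-∀* A j _ _) λ f →
                 proj₂ (Sat-stageF n _ Q args) (subst (Stage Π A n Q) (sym (⟦args⟧ f (tabulate f) refl)) (x (tabulate f))))
        where
          args = subst (Vec (Term σ (j + (N + m)))) e (∀-args {N} {m} j k zs)
          ⟦args⟧ : (f : Fin j → C) (ys : Vec C j) → tabulate f ≡ ys →
                   ⟦ args ⟧ts A (extendAll j f (extendAll N t s)) ≡ subst (Vec C) e (ys ++ᵛ map t zs)
          ⟦args⟧ f ys f≡ys = trans (⟦subst⟧ts A e _ _)
            (cong (subst (Vec C) e) (trans (⟦∀-args⟧ j k f t s zs) (cong (_++ᵛ map t zs) f≡ys)))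

bounded⇒FO : {σ : Vocab} {r : ℕ} (D : DFormula σ r) → Bounded D → Σ (Formula σ r) λ φ → EquivFO D φ
bounded⇒FO {σ} {r} D (k , Pₖ⇔P∞) = stageF k (P D) xs , λ A a →
    ⇔-trans (⇔-sym (Pₖ⇔P∞ A a)) (⇔-sym (Sat-stageF-xs A a))
  where
    open Unfold (prog D)

    xs : Vec (Term σ r) (iarity (prog D) (P D))
    xs = subst (Vec (Term σ r)) (sym (arP D)) (tabulate var)

    Sat-stageF-xs : (A : Structure σ) (a : Vec (Carrier A) r) → Sat A (lookup a) (stageF k (P D) xs) ⇔' HoldsAt D A k a
    Sat-stageF-xs A a = ⇔-trans (Sat-stageF A k (lookup a) (P D) xs) (≡⇒⇔ (cong (Stage (prog D) A k (P D)) ⟦xs⟧))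
      where
        ⟦xs⟧ : ⟦ xs ⟧ts A (lookup a) ≡ subst (Vec (Carrier A)) (sym (arP D)) a
        ⟦xs⟧ = trans (⟦subst⟧ts A (sym (arP D)) _ _)
                     (cong (subst (Vec (Carrier A)) (sym (arP D))) (trans (⟦tabulate-var⟧ A id (lookup a)) (tabulate∘lookup a)))

-- Negation normal form

module _ {σ : Vocab} where

  data ExtLit (n : ℕ) : Set where
    rel⁺ rel⁻ : (R : Fin (nRel σ)) → Vec (Term σ n) (arity σ R) → ExtLit n
    eq⁺ eq⁻   : Term σ n → Term σ n → ExtLit n

  renameˡ : {m m′ : ℕ} → (Fin m → Fin m′) → ExtLit m → ExtLit m′
  renameˡ f (rel⁺ R ts) = rel⁺ R (map (renameᵗ f) ts)
  renameˡ f (rel⁻ R ts) = rel⁻ R (map (renameᵗ f) ts)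
  renameˡ f (eq⁺ t u)   = eq⁺ (renameᵗ f t) (renameᵗ f u)
  renameˡ f (eq⁻ t u)   = eq⁻ (renameᵗ f t) (renameᵗ f u)

  toLiteral : {nI m : ℕ} {ia : Fin nI → ℕ} → ExtLit m → Literal σ ia m
  toLiteral (rel⁺ R ts) = ext+ R ts
  toLiteral (rel⁻ R ts) = ext- R ts
  toLiteral (eq⁺ t u)   = eq+ t u
  toLiteral (eq⁻ t u)   = eq- t u

  ⌜_⌝ˡ : {m : ℕ} → ExtLit m → Formula σ m
  ⌜ rel⁺ R ts ⌝ˡ = atom R ts
  ⌜ rel⁻ R ts ⌝ˡ = neg (atom R ts)
  ⌜ eq⁺ t u ⌝ˡ   = eq t u
  ⌜ eq⁻ t u ⌝ˡ   = neg (eq t u)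

  infixr 6 _∧_
  infixr 5 _∨_

  data NNF (n : ℕ) : Set where
    lit     : ExtLit n → NNF n
    _∧_ _∨_ : NNF n → NNF n → NNF n
    ∃ᴺ ∀ᴺ   : NNF (suc n) → NNF n

  mutual
    nodes : {n : ℕ} → NNF n → ℕ
    nodes ψ = suc (descendants ψ)

    descendants : {n : ℕ} → NNF n → ℕ
    descendants (lit l) = 0
    descendants (ψ ∧ χ) = nodes ψ + nodes χ
    descendants (ψ ∨ χ) = nodes ψ + nodes χ
    descendants (∃ᴺ ψ)  = nodes ψ
    descendants (∀ᴺ ψ)  = nodes ψ

  mutual
    nnf : {n : ℕ} → Formula σ n → NNF n
    nnf (atom R ts)  = lit (rel⁺ R ts)
    nnf (eq t u)     = lit (eq⁺ t u)
    nnf (neg φ)      = nnf¬ φ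
    nnf (and φ ψ)    = nnf φ ∧ nnf ψ
    nnf (or φ ψ)     = nnf φ ∨ nnf ψ
    nnf (ex φ)       = ∃ᴺ (nnf φ)
    nnf (forall' φ)  = ∀ᴺ (nnf φ)

    nnf¬ : {n : ℕ} → Formula σ n → NNF n
    nnf¬ (atom R ts) = lit (rel⁻ R ts)
    nnf¬ (eq t u)    = lit (eq⁻ t u)
    nnf¬ (neg φ)     = nnf φ
    nnf¬ (and φ ψ)   = nnf¬ φ ∨ nnf¬ ψ
    nnf¬ (or φ ψ)    = nnf¬ φ ∧ nnf¬ ψ
    nnf¬ (ex φ)      = ∀ᴺ (nnf¬ φ)
    nnf¬ (forall' φ) = ∃ᴺ (nnf¬ φ)

  module _ (A : Structure σ) where

    private
      C = Carrier A

    Sat-renameˡ : {m m′ : ℕ} (f : Fin m → Fin m′) (s : Fin m′ → C) (l : ExtLit m) →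
                  Sat A s ⌜ renameˡ f l ⌝ˡ ⇔' Sat A (s ∘ f) ⌜ l ⌝ˡ
    Sat-renameˡ f s (rel⁺ R ts) = ≡⇒⇔ (cong (T ∘ rel A R) (⟦renameᵗ⟧ts A f s ts))
    Sat-renameˡ f s (rel⁻ R ts) = ≡⇒⇔ (cong (¬_ ∘ T ∘ rel A R) (⟦renameᵗ⟧ts A f s ts))
    Sat-renameˡ f s (eq⁺ t u)   = ≡⇒⇔ (cong₂ _≡_ (⟦renameᵗ⟧ A f s t) (⟦renameᵗ⟧ A f s u))
    Sat-renameˡ f s (eq⁻ t u)   = ≡⇒⇔ (cong₂ (λ x y → ¬ x ≡ y) (⟦renameᵗ⟧ A f s t) (⟦renameᵗ⟧ A f s u))

    HoldsLit-toLiteral : {Π : Program σ} (I : Interp Π A) {m : ℕ} (s : Fin m → C) (l : ExtLit m) →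
                         HoldsLit Π A I s (toLiteral l) ≡ Sat A s ⌜ l ⌝ˡ
    HoldsLit-toLiteral I s (rel⁺ R ts) = refl
    HoldsLit-toLiteral I s (rel⁻ R ts) = refl
    HoldsLit-toLiteral I s (eq⁺ t u)   = refl
    HoldsLit-toLiteral I s (eq⁻ t u)   = refl

    SatNNF : {n : ℕ} → (Fin n → C) → NNF n → Set
    SatNNF s (lit l) = Sat A s ⌜ l ⌝ˡ
    SatNNF s (ψ ∧ χ) = SatNNF s ψ × SatNNF s χ
    SatNNF s (ψ ∨ χ) = SatNNF s ψ ⊎ SatNNF s χ
    SatNNF s (∃ᴺ ψ)  = Σ C λ a → SatNNF (extend a s) ψ
    SatNNF s (∀ᴺ ψ)  = (a : C) → SatNNF (extend a s) ψ

    SatNNF-cong : {n : ℕ} {s s′ : Fin n → C} → s ≗ s′ → (ψ : NNF n) → SatNNF s ψ → SatNNF s′ ψ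
    SatNNF-cong s≗s′ (lit l) = Sat-cong A s≗s′ ⌜ l ⌝ˡ
    SatNNF-cong s≗s′ (ψ ∧ χ) (x , y) = SatNNF-cong s≗s′ ψ x , SatNNF-cong s≗s′ χ y
    SatNNF-cong s≗s′ (ψ ∨ χ) (inj₁ x) = inj₁ (SatNNF-cong s≗s′ ψ x)
    SatNNF-cong s≗s′ (ψ ∨ χ) (inj₂ y) = inj₂ (SatNNF-cong s≗s′ χ y)
    SatNNF-cong s≗s′ (∃ᴺ ψ) (a , x) = a , SatNNF-cong (extend-cong A a s≗s′) ψ x
    SatNNF-cong s≗s′ (∀ᴺ ψ) x a = SatNNF-cong (extend-cong A a s≗s′) ψ (x a)

    SatNNF-≗ : {n : ℕ} {s s′ : Fin n → C} → s ≗ s′ → (ψ : NNF n) → SatNNF s ψ ⇔' SatNNF s′ ψ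
    SatNNF-≗ s≗s′ ψ = SatNNF-cong s≗s′ ψ , SatNNF-cong (sym ∘ s≗s′) ψ

    mutual
      Sat-nnf : {n : ℕ} (s : Fin n → C) (φ : Formula σ n) → SatNNF s (nnf φ) ⇔' Sat A s φ
      Sat-nnf s (atom R ts) = id , id
      Sat-nnf s (eq t u)    = id , id
      Sat-nnf s (neg φ)     = Sat-nnf¬ s φ
      Sat-nnf s (and φ ψ)   =
        (λ (x , y) → proj₁ (Sat-nnf s φ) x , proj₁ (Sat-nnf s ψ) y) ,
        (λ (x , y) → proj₂ (Sat-nnf s φ) x , proj₂ (Sat-nnf s ψ) y)
      Sat-nnf s (or φ ψ)    =
        Data.Sum.map (proj₁ (Sat-nnf s φ)) (proj₁ (Sat-nnf s ψ)) ,
        Data.Sum.map (proj₂ (Sat-nnf s φ)) (proj₂ (Sat-nnf s ψ))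
      Sat-nnf s (ex φ)      =
        (λ (a , x) → a , proj₁ (Sat-nnf (extend a s) φ) x) ,
        (λ (a , x) → a , proj₂ (Sat-nnf (extend a s) φ) x)
      Sat-nnf s (forall' φ) =
        (λ x a → proj₁ (Sat-nnf (extend a s) φ) (x a)) ,
        (λ x a → proj₂ (Sat-nnf (extend a s) φ) (x a))

      -- The classical steps (¬¬-elimination, de Morgan for ∧, ¬∀ ⇒ ∃¬) hold because satisfaction in a finite
      -- structure is decidable.
      Sat-nnf¬ : {n : ℕ} (s : Fin n → C) (φ : Formula σ n) → SatNNF s (nnf¬ φ) ⇔' (¬ Sat A s φ)
      Sat-nnf¬ s (atom R ts) = id , id
      Sat-nnf¬ s (eq t u)    = id , id
      Sat-nnf¬ s (neg φ)     =
        (λ x ¬φ → ¬φ (proj₁ (Sat-nnf s φ) x)) ,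
        (λ ¬¬φ → proj₂ (Sat-nnf s φ) (decidable-stable (Sat? A s φ) ¬¬φ))
      Sat-nnf¬ s (and φ ψ)   =
        (λ { (inj₁ x) (φ′ , _) → proj₁ (Sat-nnf¬ s φ) x φ′
           ; (inj₂ y) (_ , ψ′) → proj₁ (Sat-nnf¬ s ψ) y ψ′ }) ,
        (λ ¬φψ → case Sat? A s φ of λ
           { (yes φ′) → inj₂ (proj₂ (Sat-nnf¬ s ψ) λ ψ′ → ¬φψ (φ′ , ψ′))
           ; (no ¬φ)  → inj₁ (proj₂ (Sat-nnf¬ s φ) ¬φ) })
      Sat-nnf¬ s (or φ ψ)    =
        (λ { (x , y) (inj₁ φ′) → proj₁ (Sat-nnf¬ s φ) x φ′
           ; (x , y) (inj₂ ψ′) → proj₁ (Sat-nnf¬ s ψ) y ψ′ }) ,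
        (λ ¬φψ → proj₂ (Sat-nnf¬ s φ) (¬φψ ∘ inj₁) , proj₂ (Sat-nnf¬ s ψ) (¬φψ ∘ inj₂))
      Sat-nnf¬ s (ex φ)      =
        (λ x (a , φ′) → proj₁ (Sat-nnf¬ (extend a s) φ) (x a) φ′) ,
        (λ ¬∃ a → proj₂ (Sat-nnf¬ (extend a s) φ) λ φ′ → ¬∃ (a , φ′))
      Sat-nnf¬ s (forall' φ) =
        (λ (a , x) ∀φ → proj₁ (Sat-nnf¬ (extend a s) φ) x (∀φ a)) ,
        (λ ¬∀ → let (a , ¬φ) = ¬∀⟶∃¬ _ _ (λ a → Sat? A (extend a s) φ) ¬∀ in
                a , proj₂ (Sat-nnf¬ (extend a s) φ) ¬φ)

-- (i) ⇒ (ii): one intentional predicate per subformula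

inject₁-inject≤ : {m n : ℕ} (i : Fin m) .(p : m ≤ n) .(q : m ≤ suc n) → inject₁ (inject≤ i p) ≡ inject≤ i q
inject₁-inject≤ i p q = toℕ-injective (trans (toℕ-inject₁ _) (trans (toℕ-inject≤ i p) (sym (toℕ-inject≤ i q))))

lookup-padRight : {C : Set} {m n : ℕ} (m≤n : m ≤ n) (c : C) (xs : Vec C m) (i : Fin m) →
                  lookup (padRight m≤n c xs) (inject≤ i m≤n) ≡ lookup xs i
lookup-padRight (s≤s m≤n) c (x ∷ xs) zero    = refl
lookup-padRight (s≤s m≤n) c (x ∷ xs) (suc i) = lookup-padRight m≤n c xs i

module _ {n a b M : ℕ} where

  ≤-left : n + suc (a + b) ≤ M → n + a ≤ M
  ≤-left = ≤-trans (+-monoʳ-≤ n (m≤n⇒m≤1+n (m≤m+n a b)))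

  ≤-right : n + suc (a + b) ≤ M → n + b ≤ M
  ≤-right = ≤-trans (+-monoʳ-≤ n (m≤n⇒m≤1+n (m≤n+m b a)))

≤-bind : {n a M : ℕ} → n + suc a ≤ M → suc n + a ≤ M
≤-bind {n} {a} {M} = subst (_≤ M) (+-suc n a)

-- Symbol zero is the answer predicate P; the others are the nodes of θ, all of arity M. The predicate of
-- a subformula ψ with n free variables is meant to hold of a tuple iff ψ holds of its first n entries
-- (`meaning`); M = 1 + K leaves room for the variables bound above any node and lets ∀Rule quantify the
-- first of the M places (int∀ demands 1 + K ≡ M).

module Compile {σ : Vocab} {r : ℕ} (θ : NNF {σ} r) where

  N K M : ℕ
  N = nodes θ
  K = r + N
  M = suc K

  r+N≤M : r + N ≤ M
  r+N≤M = n≤1+n K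

  ι : {n : ℕ} → .(n ≤ M) → Fin n → Fin M
  ι n≤M i = inject≤ i n≤M

  vars≤ : {n : ℕ} (ψ : NNF {σ} n) → n + nodes ψ ≤ M → n ≤ M
  vars≤ {n} ψ = m+n≤o⇒m≤o n

  arityOf : Fin (suc N) → ℕ
  arityOf zero    = r
  arityOf (suc _) = M

  Rl : Set
  Rl = Rule σ arityOf

  vars : Vec (Term σ M) M
  vars = tabulate var

  pointwiseRule : Fin N → List (Literal σ arityOf M) → Rl
  pointwiseRule i body = record { nVar = M ; head = suc i ; headArgs = tabulate id ; body = body }

  atNode : Fin N → Literal σ arityOf M
  atNode j = int+ (suc j) vars

  inLeft : {n : ℕ} (ψ χ : NNF {σ} n) → Fin (nodes ψ) → Fin (suc (nodes ψ + nodes χ))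
  inLeft ψ χ = Fin.suc ∘ (_↑ˡ nodes χ)

  inRight : {n : ℕ} (ψ χ : NNF {σ} n) → Fin (nodes χ) → Fin (suc (nodes ψ + nodes χ))
  inRight ψ χ = Fin.suc ∘ (nodes ψ ↑ʳ_)

  -- Head x₁ … x_M, body R x₀ x₁ … x_{M-1}: the witness x₀ is prepended and the last place, which the
  -- subformula never reads, is dropped.
  ∃Rule : Fin N → Fin N → Rl
  ∃Rule i j = record { nVar = suc M ; head = suc i ; headArgs = tabulate suc
                     ; body = int+ (suc j) (tabulate (var ∘ inject₁)) ∷ [] }

  ∀Rule : Fin N → Fin N → Rl
  ∀Rule i j = pointwiseRule i (int∀ (suc j) 1 K refl (tabulate inject₁) ∷ [])

  -- `e` sends the nodes of ψ, numbered in preorder, to the intentional symbols.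
  rulesFor : {n : ℕ} (ψ : NNF {σ} n) → n + nodes ψ ≤ M → (Fin (nodes ψ) → Fin N) → List Rl
  rulesFor (lit l) h e = pointwiseRule (e zero) (toLiteral (renameˡ (ι (vars≤ (lit l) h)) l) ∷ []) ∷ []
  rulesFor (ψ ∧ χ) h e =
    pointwiseRule (e zero) (atNode (e (inLeft ψ χ zero)) ∷ atNode (e (inRight ψ χ zero)) ∷ []) ∷
    rulesFor ψ (≤-left {b = nodes χ} h) (e ∘ inLeft ψ χ) ++ rulesFor χ (≤-right {a = nodes ψ} h) (e ∘ inRight ψ χ)
  rulesFor (ψ ∨ χ) h e =
    pointwiseRule (e zero) (atNode (e (inLeft ψ χ zero)) ∷ []) ∷
    pointwiseRule (e zero) (atNode (e (inRight ψ χ zero)) ∷ []) ∷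
    rulesFor ψ (≤-left {b = nodes χ} h) (e ∘ inLeft ψ χ) ++ rulesFor χ (≤-right {a = nodes ψ} h) (e ∘ inRight ψ χ)
  rulesFor (∃ᴺ ψ) h e = ∃Rule (e zero) (e (suc zero)) ∷ rulesFor ψ (≤-bind h) (e ∘ Fin.suc)
  rulesFor (∀ᴺ ψ) h e = ∀Rule (e zero) (e (suc zero)) ∷ rulesFor ψ (≤-bind h) (e ∘ Fin.suc)

  -- The variables beyond the first r occur only in the body, so they are existentially quantified padding.
  topRule : Rl
  topRule = record { nVar = M ; head = zero ; headArgs = tabulate (ι (vars≤ θ r+N≤M))
                   ; body = atNode zero ∷ [] }

  Π : Program σ
  Π = record { nInt = suc N ; iarity = arityOf ; rules = topRule ∷ rulesFor θ r+N≤M id }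

  module _ (A : Structure σ) where

    private
      C = Carrier A

    meaning : {n : ℕ} (ψ : NNF {σ} n) → n + nodes ψ ≤ M → Fin (nodes ψ) → Vec C M → Set
    meaning ψ       h zero    a = SatNNF A (lookup a ∘ ι (vars≤ ψ h)) ψ
    meaning (lit l) h (suc ())
    meaning (ψ ∧ χ) h (suc i)   = (meaning ψ (≤-left {b = nodes χ} h) ++ᶠ meaning χ (≤-right {a = nodes ψ} h)) i
    meaning (ψ ∨ χ) h (suc i)   = (meaning ψ (≤-left {b = nodes χ} h) ++ᶠ meaning χ (≤-right {a = nodes ψ} h)) i
    meaning (∃ᴺ ψ)  h (suc i)   = meaning ψ (≤-bind h) i
    meaning (∀ᴺ ψ)  h (suc i)   = meaning ψ (≤-bind h) i

    ⟦_⟧ᴾ : Interp Π A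
    ⟦ zero ⟧ᴾ  a = SatNNF A (lookup a) θ
    ⟦ suc i ⟧ᴾ a = meaning θ r+N≤M i a

    record Agrees {ℓ : ℕ} (e : Fin ℓ → Fin N) (F : Fin ℓ → Vec C M → Set) : Set where
      constructor agrees
      field agree : ∀ k a → ⟦ suc (e k) ⟧ᴾ a ⇔' F k a
    open Agrees

    Agrees-suc : {ℓ : ℕ} {e : Fin (suc ℓ) → Fin N} {F : Fin (suc ℓ) → Vec C M → Set} →
                 Agrees e F → Agrees (e ∘ suc) (F ∘ suc)
    Agrees-suc e≈F = agrees (agree e≈F ∘ suc)

    Agrees-↑ˡ : {ℓ ℓ′ : ℕ} {e : Fin (ℓ + ℓ′) → Fin N}
                (F : Fin ℓ → Vec C M → Set) (G : Fin ℓ′ → Vec C M → Set) →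
                Agrees e (F ++ᶠ G) → Agrees (e ∘ (_↑ˡ ℓ′)) F
    Agrees-↑ˡ {ℓ′ = ℓ′} F G e≈F++G = agrees λ k a →
      ⇔-trans (agree e≈F++G (k ↑ˡ ℓ′) a) (≡⇒⇔ (cong-app (lookup-++ˡ F G k) a))

    Agrees-↑ʳ : {ℓ ℓ′ : ℕ} {e : Fin (ℓ + ℓ′) → Fin N}
                (F : Fin ℓ → Vec C M → Set) (G : Fin ℓ′ → Vec C M → Set) →
                Agrees e (F ++ᶠ G) → Agrees (e ∘ (ℓ ↑ʳ_)) G
    Agrees-↑ʳ {ℓ} F G e≈F++G = agrees λ k a →
      ⇔-trans (agree e≈F++G (ℓ ↑ʳ k) a) (≡⇒⇔ (cong-app (lookup-++ʳ F G k) a))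

    Agrees-root : {n : ℕ} (ψ : NNF {σ} n) {h : n + nodes ψ ≤ M} {e : Fin (nodes ψ) → Fin N} →
                  Agrees e (meaning ψ h) → (g : Fin M → C) →
                  ⟦ suc (e zero) ⟧ᴾ (tabulate g) ⇔' SatNNF A (g ∘ ι (vars≤ ψ h)) ψ
    Agrees-root ψ e≈ψ g = ⇔-trans (agree e≈ψ zero (tabulate g)) (SatNNF-≗ A (lookup∘tabulate g ∘ ι _) ψ)

    ⟦vars⟧ : (g : Fin M → C) → ⟦ vars ⟧ts A g ≡ tabulate g
    ⟦vars⟧ = ⟦tabulate-var⟧ A id

    Agrees-atNode : {n : ℕ} (ψ : NNF {σ} n) {h : n + nodes ψ ≤ M} {e : Fin (nodes ψ) → Fin N} →
                    Agrees e (meaning ψ h) → (g : Fin M → C) →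
                    HoldsLit Π A ⟦_⟧ᴾ g (atNode (e zero)) → SatNNF A (g ∘ ι (vars≤ ψ h)) ψ
    Agrees-atNode ψ {e = e} e≈ψ g = proj₁ (Agrees-root ψ e≈ψ g) ∘ subst ⟦ suc (e zero) ⟧ᴾ (⟦vars⟧ g)

    restrict-inject₁ : {n : ℕ} (s : Fin (suc M) → C) .(p : suc n ≤ M) .(q : n ≤ M) →
                       extend (s zero) (s ∘ suc ∘ ι q) ≗ s ∘ inject₁ ∘ ι p
    restrict-inject₁ s p q zero    = refl
    restrict-inject₁ s p q (suc i) = cong (s ∘ suc) (sym (inject₁-inject≤ i _ _))

    pointwise-respects : {I : Interp Π A} (i : Fin N) {body : List (Literal σ arityOf M)} →
                         ((g : Fin M → C) → All (HoldsLit Π A I g) body → I (suc i) (tabulate g)) →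
                         Respects Π A I (pointwiseRule i body)
    pointwise-respects {I} i holds g body = subst (I (suc i)) (tabulate-∘ g id) (holds g body)

    rulesFor-sound : {n : ℕ} (ψ : NNF {σ} n) (h : n + nodes ψ ≤ M) (e : Fin (nodes ψ) → Fin N) →
                     Agrees e (meaning ψ h) → All (Respects Π A ⟦_⟧ᴾ) (rulesFor ψ h e)
    rulesFor-sound (lit l) h e e≈l = pointwise-respects (e zero) respects ∷ []
      where
        l′ = renameˡ (ι (vars≤ (lit l) h)) l
        respects : (g : Fin M → C) → All (HoldsLit Π A ⟦_⟧ᴾ g) (toLiteral l′ ∷ []) → ⟦ suc (e zero) ⟧ᴾ (tabulate g)
        respects g (x ∷ []) = proj₂ (Agrees-root (lit l) e≈l g)
          (proj₁ (Sat-renameˡ A _ g l) (subst id (HoldsLit-toLiteral A {Π} ⟦_⟧ᴾ g l′) x))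
    rulesFor-sound (ψ ∧ χ) h e e≈ψ∧χ =
      pointwise-respects (e zero) (λ { g (x ∷ y ∷ []) → proj₂ (Agrees-root (ψ ∧ χ) e≈ψ∧χ g)
        (Agrees-atNode ψ e≈ψ g x , Agrees-atNode χ e≈χ g y) }) ∷
      All.++⁺ (rulesFor-sound ψ _ _ e≈ψ) (rulesFor-sound χ _ _ e≈χ)
      where
        e≈ψ = Agrees-↑ˡ _ _ (Agrees-suc e≈ψ∧χ)
        e≈χ = Agrees-↑ʳ _ _ (Agrees-suc e≈ψ∧χ)
    rulesFor-sound (ψ ∨ χ) h e e≈ψ∨χ =
      pointwise-respects (e zero) (λ { g (x ∷ []) →
        proj₂ (Agrees-root (ψ ∨ χ) e≈ψ∨χ g) (inj₁ (Agrees-atNode ψ e≈ψ g x)) }) ∷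
      pointwise-respects (e zero) (λ { g (y ∷ []) →
        proj₂ (Agrees-root (ψ ∨ χ) e≈ψ∨χ g) (inj₂ (Agrees-atNode χ e≈χ g y)) }) ∷
      All.++⁺ (rulesFor-sound ψ _ _ e≈ψ) (rulesFor-sound χ _ _ e≈χ)
      where
        e≈ψ = Agrees-↑ˡ _ _ (Agrees-suc e≈ψ∨χ)
        e≈χ = Agrees-↑ʳ _ _ (Agrees-suc e≈ψ∨χ)
    rulesFor-sound (∃ᴺ ψ) h e e≈∃ψ = ∃-respects ∷ rulesFor-sound ψ _ _ e≈ψ
      where
        e≈ψ = Agrees-suc e≈∃ψ
        ∃-respects : Respects Π A ⟦_⟧ᴾ (∃Rule (e zero) (e (suc zero)))
        ∃-respects s (x ∷ []) =
          subst ⟦ suc (e zero) ⟧ᴾ (tabulate-∘ s suc) (proj₂ (Agrees-root (∃ᴺ ψ) e≈∃ψ (s ∘ suc))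
            (s zero , SatNNF-cong A (sym ∘ restrict-inject₁ s _ _) ψ
              (proj₁ (Agrees-root ψ e≈ψ (s ∘ inject₁))
                (subst ⟦ suc (e (suc zero)) ⟧ᴾ (⟦tabulate-var⟧ A inject₁ s) x))))
    rulesFor-sound (∀ᴺ ψ) h e e≈∀ψ = pointwise-respects (e zero) respects ∷ rulesFor-sound ψ _ _ e≈ψ
      where
        e≈ψ = Agrees-suc e≈∀ψ
        respects : (g : Fin M → C) → All (HoldsLit Π A ⟦_⟧ᴾ g) (Rule.body (∀Rule (e zero) (e (suc zero)))) →
                   ⟦ suc (e zero) ⟧ᴾ (tabulate g)
        respects g (x ∷ []) = proj₂ (Agrees-root (∀ᴺ ψ) e≈∀ψ g) λ y →
          SatNNF-cong A (sym ∘ restrict-inject₁ (extend y g) _ _) ψ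
            (proj₁ (Agrees-root ψ e≈ψ (extend y g ∘ inject₁))
              (subst ⟦ suc (e (suc zero)) ⟧ᴾ (cong (y ∷_) (sym (tabulate-∘ g inject₁))) (x (y ∷ []))))

    topRule-respects : Respects Π A ⟦_⟧ᴾ topRule
    topRule-respects s (x ∷ []) = SatNNF-cong A lookup-head θ (Agrees-atNode θ {e = id} (agrees λ k a → id , id) s x)
      where
        lookup-head : s ∘ ι (vars≤ θ r+N≤M) ≗ lookup (map s (tabulate (ι (vars≤ θ r+N≤M))))
        lookup-head i = sym (trans (lookup-map i s (tabulate (ι _))) (cong s (lookup∘tabulate (ι _) i)))

    model : All (Respects Π A ⟦_⟧ᴾ) (rules Π)
    model = topRule-respects ∷ rulesFor-sound θ r+N≤M id (agrees λ k a → id , id)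

    fire-pointwise : {m : ℕ} (i : Fin N) {body : List (Literal σ arityOf M)} → pointwiseRule i body ∈ rules Π →
                     (g : Fin M → C) → All (HoldsLit Π A (Stage Π A m) g) body →
                     Stage Π A (suc m) (suc i) (tabulate g)
    fire-pointwise i ρ∈Π g body = subst (Stage Π A _ (suc i)) (sym (tabulate-∘ g id)) (Stage-fire Π A ρ∈Π g body)

    atNode-stage : {m : ℕ} (j : Fin N) (g : Fin M → C) → Stage Π A m (suc j) (tabulate g) →
                   HoldsLit Π A (Stage Π A m) g (atNode j)
    atNode-stage j g = subst (Stage Π A _ (suc j)) (sym (⟦vars⟧ g))

    rulesFor-complete : {n : ℕ} (ψ : NNF {σ} n) (h : n + nodes ψ ≤ M) (e : Fin (nodes ψ) → Fin N) →
                        rulesFor ψ h e ⊆ rules Π → ∀ m → nodes ψ ≤ m → (g : Fin M → C) →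
                        SatNNF A (g ∘ ι (vars≤ ψ h)) ψ → Stage Π A m (suc (e zero)) (tabulate g)
    rulesFor-complete (lit l) h e ⊆Π (suc m) _ g x = fire-pointwise (e zero) (⊆Π (here refl)) g
      (subst id (sym (HoldsLit-toLiteral A {Π} (Stage Π A m) g (renameˡ (ι (vars≤ (lit l) h)) l)))
        (proj₂ (Sat-renameˡ A _ g l) x) ∷ [])
    rulesFor-complete (ψ ∧ χ) h e ⊆Π (suc m) (s≤s ψχ≤m) g (x , y) =
      fire-pointwise (e zero) (⊆Π (here refl)) g (atNode-stage _ g ψ-derived ∷ atNode-stage _ g χ-derived ∷ [])
      where
        ψ-derived = rulesFor-complete ψ _ _ (⊆Π ∘ there ∘ ∈-++⁺ˡ) m (m+n≤o⇒m≤o (nodes ψ) ψχ≤m) g x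
        χ-derived = rulesFor-complete χ _ _ (⊆Π ∘ there ∘ ∈-++⁺ʳ _) m (m+n≤o⇒n≤o (nodes ψ) ψχ≤m) g y
    rulesFor-complete (ψ ∨ χ) h e ⊆Π (suc m) (s≤s ψχ≤m) g (inj₁ x) =
      fire-pointwise (e zero) (⊆Π (here refl)) g (atNode-stage _ g ψ-derived ∷ [])
      where
        ψ-derived = rulesFor-complete ψ _ _ (⊆Π ∘ there ∘ there ∘ ∈-++⁺ˡ) m (m+n≤o⇒m≤o (nodes ψ) ψχ≤m) g x
    rulesFor-complete (ψ ∨ χ) h e ⊆Π (suc m) (s≤s ψχ≤m) g (inj₂ y) =
      fire-pointwise (e zero) (⊆Π (there (here refl))) g (atNode-stage _ g χ-derived ∷ [])
      where
        χ-derived = rulesFor-complete χ _ _ (⊆Π ∘ there ∘ there ∘ ∈-++⁺ʳ _) m (m+n≤o⇒n≤o (nodes ψ) ψχ≤m) g y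
    rulesFor-complete (∃ᴺ ψ) h e ⊆Π (suc m) (s≤s ψ≤m) g (y , x) =
      subst (Stage Π A (suc m) (suc (e zero))) (sym (tabulate-∘ s suc))
        (Stage-fire Π A (⊆Π (here refl)) s
          (subst (Stage Π A m (suc (e (suc zero)))) (sym (⟦tabulate-var⟧ A inject₁ s)) ψ-derived ∷ []))
      where
        s = extend y g
        ψ-derived = rulesFor-complete ψ _ _ (⊆Π ∘ there) m ψ≤m (s ∘ inject₁) (SatNNF-cong A (restrict-inject₁ s _ _) ψ x)
    rulesFor-complete (∀ᴺ ψ) h e ⊆Π (suc m) (s≤s ψ≤m) g x =
      fire-pointwise (e zero) (⊆Π (here refl)) g ((λ { (y ∷ []) → stage-at y }) ∷ [])
      where
        stage-at : (y : C) → Stage Π A m (suc (e (suc zero))) (y ∷ map g (tabulate inject₁))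
        stage-at y = subst (Stage Π A m (suc (e (suc zero)))) (cong (y ∷_) (tabulate-∘ g inject₁))
          (rulesFor-complete ψ _ _ (⊆Π ∘ there) m ψ≤m (extend y g ∘ inject₁)
            (SatNNF-cong A (restrict-inject₁ (extend y g) _ _) ψ (x y)))

    complete : (a : Vec C r) → SatNNF A (lookup a) θ → Stage Π A (suc N) zero a
    complete a x = subst (Stage Π A (suc N) zero) head≡a (Stage-fire Π A (here refl) g (atNode-stage zero g θ-derived ∷ []))
      where
        g = lookup (padRight (vars≤ θ r+N≤M) zero a)
        padded : g ∘ ι (vars≤ θ r+N≤M) ≗ lookup a
        padded = lookup-padRight (vars≤ θ r+N≤M) zero a
        head≡a : map g (tabulate (ι (vars≤ θ r+N≤M))) ≡ a
        head≡a = trans (sym (tabulate-∘ g _)) (trans (tabulate-cong padded) (tabulate∘lookup a))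
        θ-derived = rulesFor-complete θ r+N≤M id there N ≤-refl g (SatNNF-cong A (sym ∘ padded) θ x)

  D : DFormula σ r
  D = record { prog = Π ; P = zero ; arP = refl }

  D≈θ : (A : Structure σ) (a : Vec (Carrier A) r) → HoldsD D A a ⇔' SatNNF A (lookup a) θ
  D≈θ A a = (λ (m , x) → Stage⊆model Π A (model A) m zero a x) , (λ x → suc N , complete A a x)

  D-bounded : Bounded D
  D-bounded = suc N , λ A a → (λ x → suc N , x) , (λ x → complete A a (proj₁ (D≈θ A a) x))

FO⇒bounded : {σ : Vocab} {r : ℕ} (φ : Formula σ r) → Σ (DFormula σ r) λ D → Bounded D × EquivFO D φ
FO⇒bounded φ = D , D-bounded , λ A a → ⇔-trans (D≈θ A a) (Sat-nnf A (lookup a) φ)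
  where open Compile (nnf φ)

theorem1 : (σ : Vocab) (r : ℕ) (D : DFormula σ r) →
           ((Σ (Formula σ r) λ φ → EquivFO D φ) →
             (Σ (DFormula σ r) λ D' → Bounded D' × EquivD D D'))
           × ((Σ (DFormula σ r) λ D' → Bounded D' × EquivD D D') →
             (Σ (Formula σ r) λ φ → EquivFO D φ))
theorem1 σ r D = FO⇒equivalent-bounded , bounded⇒equivalent-FO
  where
    FO⇒equivalent-bounded : (Σ (Formula σ r) λ φ → EquivFO D φ) → Σ (DFormula σ r) λ D' → Bounded D' × EquivD D D'
    FO⇒equivalent-bounded (φ , D≈φ) =
      let (D′ , D′-bounded , D′≈φ) = FO⇒bounded φ
      in D′ , D′-bounded , λ A a → ⇔-trans (D≈φ A a) (⇔-sym (D′≈φ A a))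

    bounded⇒equivalent-FO : (Σ (DFormula σ r) λ D' → Bounded D' × EquivD D D') → Σ (Formula σ r) λ φ → EquivFO D φ
    bounded⇒equivalent-FO (D′ , D′-bounded , D≈D′) =
      let (φ , D′≈φ) = bounded⇒FO D′ D′-bounded
      in φ , λ A a → ⇔-trans (D≈D′ A a) (D′≈φ A a)
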